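{- For every finite group $G$, the power graph of $G$ admits a weakly stable coloring; i.e., there is a proper coloring of the power graph of $G$ using $\chi(G)$ colors whose restriction to every cyclic subgroup $H\subseteq G$ uses exactly $\chi(H)$ colors.
   Context: The power graph of a group $K$ is the undirected graph with vertex set $K$ in which distinct $g,h$ are adjacent iff $g^k=h$ or $h^k=g$ for some positive integer $k$; $\chi(K)$ is its chromatic number. A weakly stable coloring on a finite group $K$ is a coloring of its power graph which restricts, for every cyclic subgroup $H\subseteq K$, to a coloring of the power graph of $H$ with exactly $\chi(H)$ colors. -}

module Defs where

open import Level using (0ℓ)
open import Data.Nat using (ℕ; zero; suc; _≤_; _≥_)
open import Data.Fin using (Fin)
open import Data.Product using (Σ; ∃; _×_; _,_; proj₁)
open import Data.Sum using (_⊎_)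
open import Relation.Nullary using (¬_)
open import Relation.Binary.PropositionalEquality using (_≡_; _≢_)
open import Algebra.Structures using (IsGroup)
open import Function.Definitions using (Injective)

-- A finite group: carrier Fin order (every finite group is isomorphic to one
-- of this form), with propositional equality as the group equality.
record FiniteGroup : Set where
  field
    order : ℕ
    _∙_   : Fin order → Fin order → Fin order
    ε     : Fin order
    _⁻¹   : Fin order → Fin order
    isGroup : IsGroup _≡_ _∙_ ε _⁻¹

module _ (G : FiniteGroup) where
  open FiniteGroup G

  Elt : Set
  Elt = Fin order

  pow : ℕ → Elt → Elt
  pow zero    g = ε
  pow (suc k) g = g ∙ pow k g

  Adj : Elt → Elt → Set
  Adj g h = g ≢ h ×
            ((∃ λ k → k ≥ 1 × pow k g ≡ h) ⊎ (∃ λ k → k ≥ 1 × pow k h ≡ g))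

  -- proper colouring, with colours Fin m, of the power graph induced on S
  -- (for S a subgroup this is exactly the power graph of S)
  ProperColoring : (S : Elt → Set) (m : ℕ) → (Σ Elt S → Fin m) → Set
  ProperColoring S m c = ∀ (x y : Σ Elt S) → Adj (proj₁ x) (proj₁ y) → c x ≢ c y

  Colorable : (S : Elt → Set) → ℕ → Set
  Colorable S m = Σ (Σ Elt S → Fin m) (ProperColoring S m)

  IsChromaticNumber : (S : Elt → Set) → ℕ → Set
  IsChromaticNumber S m = Colorable S m × (∀ m′ → Colorable S m′ → m ≤ m′)

  Whole : Elt → Set
  Whole _ = Data.Unit.⊤
    where import Data.Unit

  Cyclic : Elt → Elt → Set
  Cyclic g x = ∃ λ k → pow k g ≡ x

  -- the colouring c of G uses exactly r colours on S:
  -- its image on S is in bijection with Fin r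
  UsesExactly : ∀ {m} → (Elt → Fin m) → (S : Elt → Set) → ℕ → Set
  UsesExactly {m} c S r =
    Σ (Fin r → Fin m) λ f →
      Injective _≡_ _≡_ f ×
      (∀ x → S x → ∃ λ j → c x ≡ f j) ×
      (∀ j → ∃ λ x → S x × c x ≡ f j)

  WeaklyStable : (m : ℕ) → (Elt → Fin m) → Set
  WeaklyStable m c =
    ProperColoring Whole m (λ x → c (proj₁ x)) ×
    (∀ g r → IsChromaticNumber (Cyclic g) r → UsesExactly c (Cyclic g) r)

module Submission where

open import Defs
open import Data.Nat using (ℕ)
open import Data.Fin using (Fin)
open import Data.Product using (Σ)

-- Write  x ⊒ y  when y lies in the cyclic subgroup ⟨x⟩.  This is
-- a decidable preorder on G, and two distinct elements are adjacent in the
-- power graph exactly when they are ⊒-comparable: the power graph is the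
-- comparability graph of ⊒.  Breaking ties between generators of the same
-- subgroup by the rank  |⟨x⟩|·|G| + index(x)  gives a strict order ≺ with the
-- same comparability graph.  Colour every element by its level, the number of
-- elements of a longest ≺-chain strictly below it (Mirsky's colouring).
-- Comparable elements have distinct levels, so the colouring is proper.  A
-- ≺-chain is a clique, so on a down-closed set S every level is smaller than
-- the number of colours of any proper colouring of S; conversely the levels
-- occurring in S form an initial segment {0, …, M-1} and colour S properly
-- with M colours.  Cyclic subgroups are down-closed, so the levels used on
-- ⟨g⟩ are exactly 0, …, χ(⟨g⟩)-1, which is weak stability.

open import Level using (0ℓ)
open import Data.Nat using (zero; suc; _+_; _*_; _∸_; _≤_; _<_; _≥_; _⊔_; z≤n; s≤s; s≤s⁻¹; _<?_; NonZero)
open import Data.Nat.Properties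
open import Data.Nat.DivMod using (_%_; _/_; m≡m%n+[m/n]*n; m%n<n)
open import Data.Nat.Induction using (<-wellFounded)
open import Data.Fin using (zero; suc; toℕ; fromℕ<; inject≤) renaming (_≟_ to _≟ᶠ_)
open import Data.Fin.Properties
  using (toℕ-injective; toℕ-fromℕ<; toℕ-inject≤; inject≤-injective; pigeonhole; injective⇒≤; any?; toℕ<n)
open import Data.Fin.Subset using (Subset; inside; outside; _∈_; _⊆_; _⊂_; ∣_∣)
open import Data.Fin.Subset.Properties using (p⊆q⇒∣p∣≤∣q∣; p⊂q⇒∣p∣<∣q∣)
open import Data.Vec using (tabulate)
open import Data.Vec.Properties using (lookup∘tabulate; []=⇒lookup; lookup⇒[]=)
open import Data.Bool using (if_then_else_)
open import Data.Product using (∃; _×_; _,_; proj₁; proj₂)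
open import Data.Sum using (_⊎_; inj₁; inj₂)
open import Data.Unit using (tt)
open import Relation.Nullary using (¬_; Dec; yes; no; does; contradiction)
open import Relation.Nullary.Decidable using (_×-dec_)
open import Relation.Unary using (Pred; Decidable)
open import Relation.Binary using (Tri; tri<; tri≈; tri>)
open import Relation.Binary.PropositionalEquality
open import Relation.Binary.Construct.On as On using ()
open import Induction.WellFounded using (module All)
open import Function using (_∘_)
open import Algebra.Bundles using (Group)
open import Algebra.Structures using (IsGroup)

ifHolds : {A : Set} → Dec A → ℕ → ℕ
ifHolds (yes _) k = k
ifHolds (no _)  _ = 0

maxOver : ∀ {n} {P : Pred (Fin n) 0ℓ} → Decidable P → (Fin n → ℕ) → ℕ
maxOver {zero}  P? f = 0
maxOver {suc n} P? f = ifHolds (P? zero) (f zero) ⊔ maxOver (P? ∘ suc) (f ∘ suc)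

maxOver-ub : ∀ {n} {P : Pred (Fin n) 0ℓ} (P? : Decidable P) (f : Fin n → ℕ) →
             ∀ a → P a → f a ≤ maxOver P? f
maxOver-ub P? f zero pa with P? zero
... | yes _ = m≤m⊔n _ _
... | no ¬p = contradiction pa ¬p
maxOver-ub P? f (suc a) pa = ≤-trans (maxOver-ub (P? ∘ suc) (f ∘ suc) a pa) (m≤n⊔m _ _)

maxOver-cong : ∀ {n} {P : Pred (Fin n) 0ℓ} (P? : Decidable P) (f g : Fin n → ℕ) →
               (∀ a → P a → f a ≡ g a) → maxOver P? f ≡ maxOver P? g
maxOver-cong {zero}  P? f g f≗g = refl
maxOver-cong {suc n} P? f g f≗g =
  cong₂ _⊔_ head (maxOver-cong (P? ∘ suc) (f ∘ suc) (g ∘ suc) (f≗g ∘ suc))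
  where
  head : ifHolds (P? zero) (f zero) ≡ ifHolds (P? zero) (g zero)
  head with P? zero
  ... | yes p = f≗g zero p
  ... | no _  = refl

maxOver-attained : ∀ {n} {P : Pred (Fin n) 0ℓ} (P? : Decidable P) (f : Fin n → ℕ) →
                   0 < maxOver P? f → ∃ λ a → P a × f a ≡ maxOver P? f
maxOver-attained {suc n} P? f pos with P? zero
... | no _ with maxOver-attained (P? ∘ suc) (f ∘ suc) pos
...   | a , pa , fa≡max = suc a , pa , fa≡max
maxOver-attained {suc n} P? f pos | yes p
  with ⊔-sel (f zero) (maxOver (P? ∘ suc) (f ∘ suc))
...   | inj₁ max≡f0 = zero , p , sym max≡f0
...   | inj₂ max≡rest with maxOver-attained (P? ∘ suc) (f ∘ suc) (subst (0 <_) max≡rest pos)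
...     | a , pa , fa≡rest = suc a , pa , trans fa≡rest (sym max≡rest)

-- the subset of Fin n cut out by a decidable predicate, so that the library's
-- cardinality lemmas for subsets apply to down-sets
subsetOf : ∀ {n} {P : Pred (Fin n) 0ℓ} → Decidable P → Subset n
subsetOf P? = tabulate (λ x → if does (P? x) then inside else outside)

module _ {n} {P : Pred (Fin n) 0ℓ} (P? : Decidable P) where

  ∈-subsetOf⁺ : ∀ {x} → P x → x ∈ subsetOf P?
  ∈-subsetOf⁺ {x} px = lookup⇒[]= x _ (trans (lookup∘tabulate _ x) decided)
    where
    decided : (if does (P? x) then inside else outside) ≡ inside
    decided with P? x
    ... | yes _ = refl
    ... | no ¬p = contradiction px ¬p

  ∈-subsetOf⁻ : ∀ {x} → x ∈ subsetOf P? → P x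
  ∈-subsetOf⁻ {x} x∈ with P? x | trans (sym (lookup∘tabulate _ x)) ([]=⇒lookup x∈)
  ... | yes px | _ = px
  ... | no _   | ()

-- We read  x ⊒ y  as "y lies below
-- x".  The strict order ≺ refines ⊒ by a rank that strictly increases along
-- strict inclusions of down-sets and separates distinct equivalent elements;
-- the level of x is the length of a longest ≺-chain strictly below x.
module Levels {n : ℕ} (_⊒_ : Fin n → Fin n → Set)
  (⊒-refl : ∀ x → x ⊒ x) (⊒-trans : ∀ {x y z} → x ⊒ y → y ⊒ z → x ⊒ z)
  (_⊒?_ : ∀ x y → Dec (x ⊒ y)) where

  downSet : Fin n → Subset n
  downSet x = subsetOf (x ⊒?_)

  downSet-⊆ : ∀ {x y} → x ⊒ y → downSet y ⊆ downSet x
  downSet-⊆ {x} {y} x⊒y z∈ = ∈-subsetOf⁺ (x ⊒?_) (⊒-trans x⊒y (∈-subsetOf⁻ (y ⊒?_) z∈))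

  size : Fin n → ℕ
  size x = ∣ downSet x ∣

  size-mono : ∀ {x y} → x ⊒ y → size y ≤ size x
  size-mono = p⊆q⇒∣p∣≤∣q∣ ∘ downSet-⊆

  equalSize⇒⊒ : ∀ {x y} → x ⊒ y → size y ≡ size x → y ⊒ x
  equalSize⇒⊒ {x} {y} x⊒y equal with y ⊒? x
  ... | yes y⊒x = y⊒x
  ... | no y⋣x = contradiction equal (<⇒≢ (p⊂q⇒∣p∣<∣q∣ strict))
    where
    strict : downSet y ⊂ downSet x
    strict = downSet-⊆ x⊒y , x , ∈-subsetOf⁺ (x ⊒?_) (⊒-refl x) , y⋣x ∘ ∈-subsetOf⁻ (y ⊒?_)

  -- rank x = |downSet x| · n + index of x: ordered first by down-set size,
  -- with ties broken by the index, so distinct elements have distinct ranks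
  rank : Fin n → ℕ
  rank x = size x * n + toℕ x

  size<⇒rank< : ∀ {x y} → size y < size x → rank y < rank x
  size<⇒rank< {x} {y} lt = begin-strict
    size y * n + toℕ y  <⟨ +-monoʳ-< (size y * n) (toℕ<n y) ⟩
    size y * n + n      ≡⟨ +-comm (size y * n) n ⟩
    suc (size y) * n    ≤⟨ *-monoˡ-≤ n lt ⟩
    size x * n          ≤⟨ m≤m+n _ _ ⟩
    size x * n + toℕ x  ∎
    where open ≤-Reasoning

  ¬rank<⇒equalSize : ∀ {x y} → x ⊒ y → ¬ rank y < rank x → size y ≡ size x
  ¬rank<⇒equalSize {x} {y} x⊒y ¬lt with <-cmp (size y) (size x)
  ... | tri< lt _ _ = contradiction (size<⇒rank< lt) ¬lt
  ... | tri≈ _ eq _ = eq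
  ... | tri> _ _ gt = contradiction (size-mono x⊒y) (<⇒≱ gt)

  _≺_ : Fin n → Fin n → Set
  y ≺ x = x ⊒ y × rank y < rank x

  _≺?_ : ∀ y x → Dec (y ≺ x)
  y ≺? x = (x ⊒? y) ×-dec (rank y <? rank x)

  comparable : ∀ {x y} → x ⊒ y → y ≢ x → y ≺ x ⊎ x ≺ y
  comparable {x} {y} x⊒y y≢x with <-cmp (rank y) (rank x)
  ... | tri< lt _ _ = inj₁ (x⊒y , lt)
  ... | tri≈ ¬lt eq _ = contradiction (toℕ-injective sameIndex) y≢x
    where
    sameIndex : toℕ y ≡ toℕ x
    sameIndex = +-cancelˡ-≡ (size y * n) _ _
      (trans eq (cong (λ s → s * n + toℕ x) (sym (¬rank<⇒equalSize x⊒y ¬lt))))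
  ... | tri> ¬lt _ gt = inj₂ (equalSize⇒⊒ x⊒y (¬rank<⇒equalSize x⊒y ¬lt) , gt)

  rank-ind : (P : Fin n → Set) → (∀ x → (∀ {y} → rank y < rank x → P y) → P x) →
             ∀ x → P x
  rank-ind P = All.wfRec (On.wellFounded rank <-wellFounded) 0ℓ P

  levelWithin : ℕ → Fin n → ℕ
  levelWithin zero    x = 0
  levelWithin (suc k) x = maxOver (_≺? x) (suc ∘ levelWithin k)

  levelWithin-stable : ∀ k k′ x → rank x < k → rank x < k′ →
                       levelWithin k x ≡ levelWithin k′ x
  levelWithin-stable (suc k) (suc k′) x lt lt′ = maxOver-cong (_≺? x) _ _ λ y y≺x →
    cong suc (levelWithin-stable k k′ y (≤-trans (proj₂ y≺x) (s≤s⁻¹ lt))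
                                         (≤-trans (proj₂ y≺x) (s≤s⁻¹ lt′)))

  -- level x = max { level y + 1 | y ≺ x }; the definition is kept opaque, as
  -- level is only used through this equation and never computed with
  opaque
    level : Fin n → ℕ
    level x = levelWithin (suc (rank x)) x

    level-unfold : ∀ x → level x ≡ maxOver (_≺? x) (suc ∘ level)
    level-unfold x = maxOver-cong (_≺? x) _ _ λ y y≺x →
      cong suc (levelWithin-stable (rank x) (suc (rank y)) y (proj₂ y≺x) ≤-refl)

  ≺⇒level< : ∀ {x y} → y ≺ x → level y < level x
  ≺⇒level< {x} {y} y≺x =
    subst (level y <_) (sym (level-unfold x)) (maxOver-ub (_≺? x) (suc ∘ level) y y≺x)

  level-cases : ∀ x → level x ≡ 0 ⊎ ∃ λ y → y ≺ x × suc (level y) ≡ level x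
  level-cases x with level x in eq
  ... | zero  = inj₁ refl
  ... | suc _ with maxOver-attained (_≺? x) (suc ∘ level)
                     (subst (0 <_) (trans (sym eq) (level-unfold x)) (s≤s z≤n))
  ...   | y , y≺x , attains = inj₂ (y , y≺x , trans attains (trans (sym (level-unfold x)) eq))

  comparable⇒level≢ : ∀ {x y} → x ⊒ y → y ≢ x → level y ≢ level x
  comparable⇒level≢ x⊒y y≢x with comparable x⊒y y≢x
  ... | inj₁ y≺x = <⇒≢ (≺⇒level< y≺x)
  ... | inj₂ x≺y = ≢-sym (<⇒≢ (≺⇒level< x≺y))

  -- a ≺-chain of k elements, all below x; the rank bound is recorded because ⊒
  -- alone does not bound ranks (equivalent elements may have larger rank)
  record Chain (x : Fin n) (k : ℕ) : Set where
    field
      elem       : Fin k → Fin n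
      below      : ∀ i → x ⊒ elem i
      rank≤      : ∀ i → rank (elem i) ≤ rank x
      descending : ∀ i j → toℕ i < toℕ j → elem j ≺ elem i

  singleton : ∀ x → Chain x 1
  singleton x = record
    { elem = λ _ → x ; below = λ _ → ⊒-refl x ; rank≤ = λ _ → ≤-refl
    ; descending = λ { zero zero () } }

  extend : ∀ {x y k} → y ≺ x → Chain y k → Chain x (suc k)
  extend {x} {y} {k} (x⊒y , y<x) c = record
    { elem = elem′ ; below = below′ ; rank≤ = rank≤′ ; descending = descending′ }
    where
    open Chain c
    elem′ : Fin (suc k) → Fin n
    elem′ zero    = x
    elem′ (suc i) = elem i
    below′ : ∀ i → x ⊒ elem′ i
    below′ zero    = ⊒-refl x
    below′ (suc i) = ⊒-trans x⊒y (below i)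
    rank≤′ : ∀ i → rank (elem′ i) ≤ rank x
    rank≤′ zero    = ≤-refl
    rank≤′ (suc i) = ≤-trans (rank≤ i) (<⇒≤ y<x)
    descending′ : ∀ i j → toℕ i < toℕ j → elem′ j ≺ elem′ i
    descending′ zero    (suc j) _  = ⊒-trans x⊒y (below j) , ≤-<-trans (rank≤ j) y<x
    descending′ (suc i) (suc j) lt = descending i j (s≤s⁻¹ lt)

  longestChain : ∀ x → Chain x (suc (level x))
  longestChain = rank-ind (λ x → Chain x (suc (level x))) step
    where
    step : ∀ x → (∀ {y} → rank y < rank x → Chain y (suc (level y))) →
           Chain x (suc (level x))
    step x ih with level-cases x
    ... | inj₁ level≡0 = subst (Chain x) (cong suc (sym level≡0)) (singleton x)
    ... | inj₂ (y , y≺x , level≡) =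
      subst (Chain x) (cong suc level≡) (extend y≺x (ih (proj₂ y≺x)))

  levelsBelow : ∀ x v → v ≤ level x → ∃ λ y → x ⊒ y × level y ≡ v
  levelsBelow = rank-ind (λ x → ∀ v → v ≤ level x → ∃ λ y → x ⊒ y × level y ≡ v) step
    where
    step : ∀ x → (∀ {y} → rank y < rank x → ∀ v → v ≤ level y →
                   ∃ λ z → y ⊒ z × level z ≡ v) →
           ∀ v → v ≤ level x → ∃ λ y → x ⊒ y × level y ≡ v
    step x ih v v≤level with v ≟ level x | level-cases x
    ... | yes v≡ | _ = x , ⊒-refl x , sym v≡
    ... | no v≢ | inj₁ level≡0 =
      contradiction (trans (n≤0⇒n≡0 (subst (v ≤_) level≡0 v≤level)) (sym level≡0)) v≢
    ... | no v≢ | inj₂ (y , (x⊒y , y<x) , level≡)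
      with z , y⊒z , level≡v ← ih y<x v (s≤s⁻¹ (subst (v <_) (sym level≡) (≤∧≢⇒< v≤level v≢)))
      = z , ⊒-trans x⊒y y⊒z , level≡v

module PowerGraph (G : FiniteGroup) where
  open FiniteGroup G
  open IsGroup isGroup using (assoc; identityˡ; identityʳ)

  -- G as a library group, to use its cancellation law
  asGroup : Group 0ℓ 0ℓ
  asGroup = record { isGroup = isGroup }

  open import Algebra.Properties.Group asGroup using (∙-cancelˡ)

  pow-+ : ∀ a b g → pow G (a + b) g ≡ pow G a g ∙ pow G b g
  pow-+ zero    b g = sym (identityˡ _)
  pow-+ (suc a) b g = trans (cong (g ∙_) (pow-+ a b g)) (sym (assoc g _ _))

  pow-ε : ∀ a → pow G a ε ≡ ε
  pow-ε zero    = refl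
  pow-ε (suc a) = trans (identityˡ _) (pow-ε a)

  pow-* : ∀ a b g → pow G (a * b) g ≡ pow G a (pow G b g)
  pow-* zero    b g = refl
  pow-* (suc a) b g = trans (pow-+ b (a * b) g) (cong (pow G b g ∙_) (pow-* a b g))

  -- every element has finite order: two of g⁰, …, g^|G| coincide
  finiteOrder : ∀ g → ∃ λ p → pow G (suc p) g ≡ ε
  finiteOrder g with pigeonhole (n<1+n order) (λ (i : Fin (suc order)) → pow G (toℕ i) g)
  ... | i , j , i<j , gⁱ≡gʲ = d ∸ 1 , gᵈ≡ε
    where
    d : ℕ
    d = toℕ j ∸ toℕ i
    gⁱ∙ε≡gⁱ∙gᵈ : pow G (toℕ i) g ∙ ε ≡ pow G (toℕ i) g ∙ pow G d g
    gⁱ∙ε≡gⁱ∙gᵈ = begin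
      pow G (toℕ i) g ∙ ε            ≡⟨ identityʳ _ ⟩
      pow G (toℕ i) g                ≡⟨ gⁱ≡gʲ ⟩
      pow G (toℕ j) g                ≡⟨ cong (λ k → pow G k g) (sym (m+[n∸m]≡n (<⇒≤ i<j))) ⟩
      pow G (toℕ i + d) g            ≡⟨ pow-+ (toℕ i) d g ⟩
      pow G (toℕ i) g ∙ pow G d g    ∎
      where open ≡-Reasoning
    gᵈ≡ε : pow G (suc (d ∸ 1)) g ≡ ε
    gᵈ≡ε = trans (cong (λ k → pow G k g) (trans (+-comm 1 (d ∸ 1)) (m∸n+n≡m (m<n⇒0<n∸m i<j))))
                 (sym (∙-cancelˡ _ _ _ gⁱ∙ε≡gⁱ∙gᵈ))

  pow-% : ∀ k p g .{{_ : NonZero p}} → pow G p g ≡ ε → pow G (k % p) g ≡ pow G k g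
  pow-% k p g gᵖ≡ε = begin
    pow G (k % p) g                        ≡⟨ identityʳ _ ⟨
    pow G (k % p) g ∙ ε                    ≡⟨ cong (pow G (k % p) g ∙_) gᵖᵠ≡ε ⟨
    pow G (k % p) g ∙ pow G (k / p * p) g  ≡⟨ pow-+ (k % p) (k / p * p) g ⟨
    pow G (k % p + k / p * p) g            ≡⟨ cong (λ j → pow G j g) (m≡m%n+[m/n]*n k p) ⟨
    pow G k g                              ∎
    where
    open ≡-Reasoning
    gᵖᵠ≡ε : pow G (k / p * p) g ≡ ε
    gᵖᵠ≡ε = trans (pow-* (k / p) p g) (trans (cong (pow G (k / p)) gᵖ≡ε) (pow-ε (k / p)))

  cyclic-refl : ∀ x → Cyclic G x x
  cyclic-refl x = 1 , identityʳ x

  cyclic-trans : ∀ {x y z} → Cyclic G x y → Cyclic G y z → Cyclic G x z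
  cyclic-trans {x} (b , xᵇ≡y) (a , yᵃ≡z) = a * b , trans (pow-* a b x) (trans (cong (pow G a) xᵇ≡y) yᵃ≡z)

  -- membership in ⟨g⟩ is decided by the finitely many powers below the order
  cyclic? : ∀ g x → Dec (Cyclic G g x)
  cyclic? g x with finiteOrder g
  ... | p , gᵖ≡ε with any? (λ (i : Fin (suc p)) → pow G (toℕ i) g ≟ᶠ x)
  ...   | yes (i , gⁱ≡x) = yes (toℕ i , gⁱ≡x)
  ...   | no ¬small = no λ (k , gᵏ≡x) →
          ¬small (fromℕ< (m%n<n k (suc p)) ,
                  trans (cong (λ j → pow G j g) (toℕ-fromℕ< (m%n<n k (suc p))))
                        (trans (pow-% k (suc p) g gᵖ≡ε) gᵏ≡x))

  cyclic⇒positivePower : ∀ {g x} → Cyclic G g x → ∃ λ k → k ≥ 1 × pow G k g ≡ x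
  cyclic⇒positivePower {g} (zero , ε≡x) with finiteOrder g
  ... | p , gᵖ≡ε = suc p , s≤s z≤n , trans gᵖ≡ε ε≡x
  cyclic⇒positivePower (suc k , gᵏ≡x) = suc k , s≤s z≤n , gᵏ≡x

  open Levels (Cyclic G) cyclic-refl cyclic-trans cyclic? public

  adjacent⇒level≢ : ∀ {g h} → Adj G g h → level g ≢ level h
  adjacent⇒level≢ (g≢h , inj₁ (k , _ , gᵏ≡h)) = ≢-sym (comparable⇒level≢ (k , gᵏ≡h) (≢-sym g≢h))
  adjacent⇒level≢ (g≢h , inj₂ (k , _ , hᵏ≡g)) = comparable⇒level≢ (k , hᵏ≡g) g≢h

  ≺⇒adjacent : ∀ {x y} → y ≺ x → Adj G x y
  ≺⇒adjacent (x⊒y , y<x) =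
    (λ x≡y → <-irrefl (cong rank (sym x≡y)) y<x) , inj₁ (cyclic⇒positivePower x⊒y)

  DownClosed : (Elt G → Set) → Set
  DownClosed S = ∀ {x y} → S x → Cyclic G x y → S y

  -- a chain is a clique, so on a down-closed S every level is smaller than the
  -- number of colours of any proper colouring of S
  level<colours : ∀ {S r} (d : Σ (Elt G) S → Fin r) → DownClosed S →
                  ProperColoring G S r d → ∀ {x} → S x → level x < r
  level<colours {S} {r} d closed proper {x} sx = injective⇒≤ {f = d ∘ member} injective
    where
    open Chain (longestChain x)
    member : Fin (suc (level x)) → Σ (Elt G) S
    member i = elem i , closed sx (below i)
    -- two members of the chain are adjacent, so their colours differ
    injective : ∀ {i j} → d (member i) ≡ d (member j) → i ≡ j
    injective {i} {j} same = byCases (<-cmp (toℕ i) (toℕ j))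
      where
      byCases : Tri (toℕ i < toℕ j) (toℕ i ≡ toℕ j) (toℕ j < toℕ i) → i ≡ j
      byCases (tri< i<j _ _) =
        contradiction same (proper (member i) (member j) (≺⇒adjacent (descending i j i<j)))
      byCases (tri≈ _ i≡j _) = toℕ-injective i≡j
      byCases (tri> _ _ j<i) =
        contradiction (sym same) (proper (member j) (member i) (≺⇒adjacent (descending j i j<i)))

  levelColouring : ∀ {S M} (bound : ∀ x → S x → level x < M) →
                   ProperColoring G S M (λ (x , sx) → fromℕ< (bound x sx))
  levelColouring bound (x , sx) (y , sy) adj same = adjacent⇒level≢ adj
    (trans (sym (toℕ-fromℕ< (bound x sx))) (trans (cong toℕ same) (toℕ-fromℕ< (bound y sy))))

  levelsExactly : ∀ {S r x₀} → Decidable S → DownClosed S → S x₀ → IsChromaticNumber G S r →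
                  (∀ {x} → S x → level x < r) × (∀ v → v < r → ∃ λ x → S x × level x ≡ v)
  levelsExactly {S} {r} {x₀} S? closed sx₀ ((d , proper) , minimal) =
    level<colours d closed proper , onto
    where
    M : ℕ
    M = maxOver S? (suc ∘ level)
    level<M : ∀ x → S x → level x < M
    level<M = maxOver-ub S? (suc ∘ level)
    r≤M : r ≤ M
    r≤M = minimal M ((λ (x , sx) → fromℕ< (level<M x sx)) , levelColouring level<M)
    onto : ∀ v → v < r → ∃ λ x → S x × level x ≡ v
    onto v v<r with x , sx , M≡ ← maxOver-attained S? (suc ∘ level) (≤-trans (s≤s z≤n) (level<M x₀ sx₀))
      with y , x⊒y , level≡v ← levelsBelow x v (s≤s⁻¹ (≤-trans v<r (≤-trans r≤M (≤-reflexive (sym M≡)))))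
      = y , closed sx x⊒y , level≡v

  usesExactly : ∀ {m r S} (c : Elt G → Fin m) (φ : Elt G → ℕ) → (∀ x → toℕ (c x) ≡ φ x) →
                r ≤ m → (∀ {x} → S x → φ x < r) → (∀ v → v < r → ∃ λ x → S x × φ x ≡ v) →
                UsesExactly G c S r
  usesExactly {S = S} c φ c≡φ r≤m inRange onto =
    (λ j → inject≤ j r≤m) , inject≤-injective r≤m r≤m _ _ , covered , hit
    where
    covered : ∀ x → S x → ∃ λ j → c x ≡ inject≤ j r≤m
    covered x sx = fromℕ< (inRange sx) , toℕ-injective
      (trans (c≡φ x) (trans (sym (toℕ-fromℕ< (inRange sx))) (sym (toℕ-inject≤ _ r≤m))))
    hit : ∀ j → ∃ λ x → S x × c x ≡ inject≤ j r≤m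
    hit j = let (x , sx , φx≡j) = onto (toℕ j) (toℕ<n j) in
      x , sx , toℕ-injective (trans (c≡φ x) (trans φx≡j (sym (toℕ-inject≤ j r≤m))))

  restrict : ∀ {m} (S : Elt G → Set) → Colorable G (Whole G) m → Colorable G S m
  restrict S (d , proper) = (λ (x , _) → d (x , tt)) , λ (x , _) (y , _) → proper (x , tt) (y , tt)

mainTheorem11 : (G : FiniteGroup) (m : ℕ) → IsChromaticNumber G (Whole G) m →
                Σ (Elt G → Fin m) (WeaklyStable G m)
mainTheorem11 G m (colourable@(d , proper) , _) = colour , levelColouring level<m , stable
  where
  open PowerGraph G
  level<m : ∀ x → Whole G x → level x < m
  level<m x _ = level<colours d (λ _ _ → tt) proper tt
  colour : Elt G → Fin m
  colour x = fromℕ< (level<m x tt)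
  stable : ∀ g r → IsChromaticNumber G (Cyclic G g) r → UsesExactly G colour (Cyclic G g) r
  stable g r χ = usesExactly colour level (λ x → toℕ-fromℕ< (level<m x tt)) r≤m
                             (proj₁ exact) (proj₂ exact)
    where
    r≤m : r ≤ m
    r≤m = proj₂ χ m (restrict (Cyclic G g) colourable)
    exact : (∀ {x} → Cyclic G g x → level x < r) × (∀ v → v < r → ∃ λ x → Cyclic G g x × level x ≡ v)
    exact = levelsExactly (cyclic? g) cyclic-trans (cyclic-refl g) χ
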